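{- Let $\preceq$ be a linear order on a set $L\cup R$ with corresponding strict linear order $\prec$, such that $v\in L$ and $u\in R$ imply $v\prec u$. Let $B$ be a set of at least $2k-1$ pairs $(u,v)$ with $u\in R$ and $v\in L$, and let $W\subseteq L\cup R$ be a set such that for every pair $(u,v)\in B$ there is a $w\in W$ with $v\prec w\preceq u$. Then there exists $w\in W$ such that there are at least $k$ pairs $(x,y)\in B$ with $y\prec w\preceq x$. -}

module Defs where

open import Level using (Level)
open import Data.Product using (_×_; _,_)
open import Data.Sum using (_⊎_)
open import Relation.Binary.Core using (Rel)
open import Relation.Binary.PropositionalEquality using (_≡_)

Refl≺ : ∀ {a ℓ} {A : Set a} → Rel A ℓ → A → A → Set (a Level.⊔ ℓ)
Refl≺ _≺_ x y = (x ≺ y) ⊎ (x ≡ y)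

Covers : ∀ {a ℓ} {A : Set a} → Rel A ℓ → A → A × A → Set (a Level.⊔ ℓ)
Covers _≺_ w (u , v) = (v ≺ w) × Refl≺ _≺_ w u

-- Give every pair of B a witness from W. Some pairs have their witness in L,
-- the others in R, so one of these two classes contains at least k + 1 pairs.
-- If it is the L-class, the largest of their witnesses, w, still lies above
-- every v, and being in L it lies below every u; so w works for the whole
-- class. Symmetrically the smallest witness works for the R-class.
module Submission where

open import Defs
open import Level using (Level; _⊔_)
open import Data.Nat using (ℕ; suc; _+_; _≤_; _≤?_; s≤s; z≤n)
open import Data.Nat.Properties using (≤-trans; +-cancelˡ-≤; +-monoˡ-≤; +-suc; ≰⇒>; ≤-pred; module ≤-Reasoning)
open import Data.Product using (_×_; _,_; ∃-syntax)
open import Data.Sum using (_⊎_; inj₁; inj₂; [_,_]′)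
open import Data.List using (List; length; []; _∷_)
open import Data.List.Membership.Propositional using (_∈_)
open import Data.List.Relation.Unary.All using (All; []; _∷_)
import Data.List.Relation.Unary.All as All
open import Data.List.Relation.Unary.AllPairs using (AllPairs; []; _∷_)
open import Data.List.Relation.Unary.Unique.Propositional using (Unique)
open import Data.List.Relation.Binary.Sublist.Propositional using (_⊆_; _⊇_; []; _∷_; _∷ʳ_; lookup)
open import Data.List.Relation.Binary.Sublist.Propositional.Properties using (All-resp-⊆)
open import Relation.Binary.Core using (Rel)
open import Relation.Binary.Definitions using (_Respects_; tri<; tri≈; tri>)
open import Relation.Binary.Structures using (IsStrictTotalOrder)
import Relation.Binary.Construct.Flip.EqAndOrd as Flip
open import Relation.Binary.PropositionalEquality using (_≡_; refl; cong; trans; sym; subst)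
open import Relation.Nullary using (yes; no)
open import Relation.Unary using (Pred; _∪_; _∩_)

private
  variable
    a b ℓ p q : Level
    A X : Set a

AllPairs-resp-⊇ : {_~_ : Rel A ℓ} → (AllPairs _~_) Respects _⊇_
AllPairs-resp-⊇ []         []         = []
AllPairs-resp-⊇ (_ ∷ʳ τ)   (_ ∷ rs)   = AllPairs-resp-⊇ τ rs
AllPairs-resp-⊇ (refl ∷ τ) (r ∷ rs)   = All-resp-⊆ τ r ∷ AllPairs-resp-⊇ τ rs

Unique-resp-⊇ : (Unique {A = A}) Respects _⊇_
Unique-resp-⊇ = AllPairs-resp-⊇

⊆⇒All-∈ : {xs ys : List A} → xs ⊆ ys → All (_∈ ys) xs
⊆⇒All-∈ τ = All.tabulate (lookup τ)

record Split {A : Set a} (P : Pred A p) (Q : Pred A q) (xs : List A) : Set (a ⊔ p ⊔ q) where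
  field
    left right   : List A
    left⊆        : left ⊆ xs
    right⊆       : right ⊆ xs
    all-left     : All P left
    all-right    : All Q right
    length-split : length left + length right ≡ length xs

split : {P : Pred A p} {Q : Pred A q} {xs : List A} → All (P ∪ Q) xs → Split P Q xs
split [] = record
  { left = [] ; right = [] ; left⊆ = [] ; right⊆ = []
  ; all-left = [] ; all-right = [] ; length-split = refl }
split {xs = x ∷ xs} (inj₁ px ∷ pqs) = record
  { left = x ∷ left ; right = right ; left⊆ = refl ∷ left⊆ ; right⊆ = x ∷ʳ right⊆
  ; all-left = px ∷ all-left ; all-right = all-right ; length-split = cong suc length-split }
  where open Split (split pqs)
split {xs = x ∷ xs} (inj₂ qx ∷ pqs) = record
  { left = left ; right = x ∷ right ; left⊆ = x ∷ʳ left⊆ ; right⊆ = refl ∷ right⊆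
  ; all-left = all-left ; all-right = qx ∷ all-right
  ; length-split = trans (+-suc (length left) (length right)) (cong suc length-split) }
  where open Split (split pqs)

pigeonhole-+ : ∀ k m n → suc (k + k) ≤ m + n → suc k ≤ m ⊎ suc k ≤ n
pigeonhole-+ k m n k+k<m+n with suc k ≤? m
... | yes k<m = inj₁ k<m
... | no k≮m = inj₂ (+-cancelˡ-≤ k (suc k) n (begin
  k + suc k  ≡⟨ +-suc k k ⟩
  suc (k + k) ≤⟨ k+k<m+n ⟩
  m + n      ≤⟨ +-monoˡ-≤ n (≤-pred (≰⇒> k≮m)) ⟩
  k + n      ∎))
  where open ≤-Reasoning

-- The common bound is the <-largest of the given points; for the flipped order
-- it is the smallest one.
module _ {_<_ : Rel A ℓ} (sto : IsStrictTotalOrder _≡_ _<_)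
         (_◃_ : X → A → Set b) (◃-mono : ∀ {x w w′} → x ◃ w → w < w′ → x ◃ w′)
         {P : Pred A p} where

  open IsStrictTotalOrder sto using (compare)

  common-bound : ∀ {y ys} → All (λ x → ∃[ w ] (P w × x ◃ w)) (y ∷ ys)
               → ∃[ w ] (P w × All (_◃ w) (y ∷ ys))
  common-bound ((w , Pw , y◃w) ∷ []) = w , Pw , y◃w ∷ []
  common-bound ((w , Pw , y◃w) ∷ bs@(_ ∷ _)) with common-bound bs
  ... | w′ , Pw′ , ys◃w′ with compare w w′
  ... | tri< w<w′ _ _ = w′ , Pw′ , ◃-mono y◃w w<w′ ∷ ys◃w′
  ... | tri≈ _ refl _ = w′ , Pw′ , y◃w ∷ ys◃w′
  ... | tri> _ _ w′<w = w , Pw , y◃w ∷ All.map (λ x◃w′ → ◃-mono x◃w′ w′<w) ys◃w′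

module Witnesses {r} {A : Set a} (_≺_ : Rel A ℓ) (sto : IsStrictTotalOrder _≡_ _≺_)
         (L : Pred A p) (R : Pred A q) (L⊎R : ∀ x → L x ⊎ R x)
         (L≺R : ∀ v u → L v → R u → v ≺ u) (W : Pred A r) where

  open IsStrictTotalOrder sto using () renaming (trans to ≺-trans)

  ≺-≼-trans : ∀ {w′ w u} → w′ ≺ w → Refl≺ _≺_ w u → w′ ≺ u
  ≺-≼-trans w′≺w (inj₁ w≺u) = ≺-trans w′≺w w≺u
  ≺-≼-trans w′≺w (inj₂ refl) = w′≺w

  Straddles : Pred (A × A) (p ⊔ q)
  Straddles (u , v) = R u × L v

  WitnessedIn : Pred A b → Pred (A × A) (a ⊔ ℓ ⊔ r ⊔ b)
  WitnessedIn P uv = ∃[ w ] ((W ∩ P) w × Covers _≺_ w uv)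

  witness-side : ∀ {uv} → ∃[ w ] (W w × Covers _≺_ w uv) → (WitnessedIn L ∪ WitnessedIn R) uv
  witness-side (w , Ww , covers) with L⊎R w
  ... | inj₁ Lw = inj₁ (w , (Ww , Lw) , covers)
  ... | inj₂ Rw = inj₂ (w , (Ww , Rw) , covers)

  left-witness : ∀ {S} → 1 ≤ length S → All Straddles S → All (WitnessedIn L) S
               → ∃[ w ] (W w × All (Covers _≺_ w) S)
  left-witness {_ ∷ _} _ straddles witnessed
    with common-bound sto (λ (_ , v) w → v ≺ w) ≺-trans
           (All.map (λ (w , W∩Lw , (v≺w , _)) → w , W∩Lw , v≺w) witnessed)
  ... | w , (Ww , Lw) , below-w =
    w , Ww , All.zipWith (λ (v≺w , (Ru , _)) → v≺w , inj₁ (L≺R _ _ Lw Ru)) (below-w , straddles)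

  right-witness : ∀ {S} → 1 ≤ length S → All Straddles S → All (WitnessedIn R) S
                → ∃[ w ] (W w × All (Covers _≺_ w) S)
  right-witness {_ ∷ _} _ straddles witnessed
    with common-bound (Flip.isStrictTotalOrder sto) (λ (u , _) w → Refl≺ _≺_ w u)
           (λ w≼u w′≺w → inj₁ (≺-≼-trans w′≺w w≼u))
           (All.map (λ (w , W∩Rw , (_ , w≼u)) → w , W∩Rw , w≼u) witnessed)
  ... | w , (Ww , Rw) , above-w =
    w , Ww , All.zipWith (λ (w≼u , (_ , Lv)) → L≺R _ _ Lv Rw , w≼u) (above-w , straddles)

mainTheorem8 : ∀ {a ℓ p q r} {A : Set a} (_≺_ : Rel A ℓ)
    → IsStrictTotalOrder _≡_ _≺_
    → (L : A → Set p) (R : A → Set q)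
    → (∀ x → L x ⊎ R x)
    → (∀ v u → L v → R u → v ≺ u)
    → (k : ℕ) (B : List (A × A))
    → Unique B
    → All (λ uv → R (Data.Product.proj₁ uv) × L (Data.Product.proj₂ uv)) B
    → suc (k + k) ≤ length B
    → (W : A → Set r)
    → All (λ uv → ∃[ w ] (W w × Covers _≺_ w uv)) B
    → ∃[ w ] (W w × ∃[ S ] (Unique S × All (_∈ B) S × All (Covers _≺_ w) S × suc k ≤ length S))
mainTheorem8 _≺_ sto L R L⊎R L≺R k B unique-B straddles size W covered =
  [ (λ big → conclude left⊆ big
               (left-witness (≤-trans (s≤s z≤n) big) (All-resp-⊆ left⊆ straddles) all-left))
  , (λ big → conclude right⊆ big
               (right-witness (≤-trans (s≤s z≤n) big) (All-resp-⊆ right⊆ straddles) all-right))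
  ]′ (pigeonhole-+ k (length left) (length right) (subst (suc (k + k) ≤_) (sym length-split) size))
  where
  open Witnesses _≺_ sto L R L⊎R L≺R W
  open Split (split (All.map witness-side covered))

  conclude : ∀ {S} → S ⊆ B → suc k ≤ length S → ∃[ w ] (W w × All (Covers _≺_ w) S)
           → ∃[ w ] (W w × ∃[ S ] (Unique S × All (_∈ B) S × All (Covers _≺_ w) S × suc k ≤ length S))
  conclude τ big (w , Ww , covers) = w , Ww , _ , Unique-resp-⊇ τ unique-B , ⊆⇒All-∈ τ , covers , big
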